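{- Let $\mathbb{A}=(L,\wedge,\vee,{}',\top,\bot)$ be a semi De Morgan algebra (in particular, possibly a demi pseudocomplemented lattice), and let $K$, $h$, $e$ and $\mathbb{K}_{\mathbb{A}}$ be as below. Then $h$ is a lattice homomorphism from $(L,\wedge,\vee)$ onto $(K,\cap,\cup)$, and for all $\alpha,\beta\in K$: $e(\alpha)\wedge e(\beta)=e(\alpha\cap\beta)$, $e(1)=\top$ and $e(0)=\bot$.
   Context: A semi De Morgan algebra (SMA) is an algebra $(L,\wedge,\vee,{}',\top,\bot)$ such that $(L,\wedge,\vee,\top,\bot)$ is a bounded distributive lattice and for all $a,b\in L$: $\bot'=\top$, $\top'=\bot$, $(a\vee b)'=a'\wedge b'$, $(a\wedge b)''=a''\wedge b''$, $a'=a'''$. A demi pseudocomplemented lattice is an SMA with $a'\wedge a''=\bot$ for all $a$. Let $K=\{a'':a\in L\}$, $h:L\to K$ given by $h(a)=a''$, and $e:K\to L$ the inclusion. The kernel $\mathbb{K}_{\mathbb{A}}=(K,\cap,\cup,{}^*,1,0)$ is defined by $\alpha\cup\beta=h((e(\alpha)\vee e(\beta))'')$, $\alpha\cap\beta=h(e(\alpha)\wedge e(\beta))$, $1=h(\top)$, $0=h(\bot)$, $\alpha^*=h(e(\alpha)')$. -}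

module Defs where

open import Level using (Level; suc; _⊔_)
open import Data.Product using (Σ; ∃; _,_; proj₁)
open import Relation.Binary.PropositionalEquality using (_≡_; refl)
open import Algebra.Core using (Op₁; Op₂)
open import Algebra.Definitions using (Identity)
open import Algebra.Lattice.Structures using (IsDistributiveLattice)

record SemiDeMorganAlgebra (c : Level) : Set (suc c) where
  infixr 6 _∨_
  infixr 7 _∧_
  infix 8 _′
  field
    Carrier : Set c
    _∧_ : Op₂ Carrier
    _∨_ : Op₂ Carrier
    _′  : Op₁ Carrier
    ⊤ : Carrier
    ⊥ : Carrier
    isDistributiveLattice : IsDistributiveLattice _≡_ _∨_ _∧_
    ∧-identity : Identity _≡_ ⊤ _∧_
    ∨-identity : Identity _≡_ ⊥ _∨_
    ⊥′≡⊤ : ⊥ ′ ≡ ⊤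
    ⊤′≡⊥ : ⊤ ′ ≡ ⊥
    ∨-′ : ∀ a b → (a ∨ b) ′ ≡ a ′ ∧ b ′
    ∧-′′ : ∀ a b → ((a ∧ b) ′) ′ ≡ (a ′) ′ ∧ (b ′) ′
    ′′′ : ∀ a → a ′ ≡ ((a ′) ′) ′

IsDemiPseudocomplemented : ∀ {c} → SemiDeMorganAlgebra c → Set c
IsDemiPseudocomplemented A = ∀ a → a ′ ∧ (a ′) ′ ≡ ⊥
  where open SemiDeMorganAlgebra A

module Kernel {c} (A : SemiDeMorganAlgebra c) where
  open SemiDeMorganAlgebra A

  -- K = { a′′ : a ∈ L } as a subset of L; elements of K are equal
  -- when their underlying elements of L are equal (i.e. when e agrees).
  K : Set c
  K = Σ Carrier (λ x → ∃ (λ a → x ≡ (a ′) ′))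

  h : Carrier → K
  h a = ((a ′) ′ , a , refl)

  e : K → Carrier
  e = proj₁

  infix 4 _≈K_
  _≈K_ : K → K → Set c
  α ≈K β = e α ≡ e β

  infixr 6 _∪_
  infixr 7 _∩_
  _∪_ : K → K → K
  α ∪ β = h (((e α ∨ e β) ′) ′)

  _∩_ : K → K → K
  α ∩ β = h (e α ∧ e β)

  𝟙 : K
  𝟙 = h ⊤

  𝟘 : K
  𝟘 = h ⊥

  _* : K → K
  α * = h (e α ′)

module Submission where

-- Everything rests on two consequences of the axiom a′ = a′′′:
--   * prime-absorbs-′′ : (a′′)′ = a′, so a double prime can be dropped
--     under a further prime, and hence
--   * ′′-idempotent    : (a′′)′′ = a′′, i.e. every element of K is a fixed
--     point of ′′ (e-fixed).
-- Meets: h (a ∧ b) = (a ∧ b)′′ = a′′ ∧ b′′ by the ∧-′′ axiom, and a′′ ∧ b′′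
-- is again a fixed point of ′′, which gives both the ∩-clause for h and
-- the fact that e α ∧ e β lies in K unchanged.  Joins: De Morgan for ∨
-- together with prime-absorbs-′′ shows (a′′ ∨ b′′)′ = (a ∨ b)′.

open import Defs
open import Level using (Level)
open import Data.Product using (_×_; ∃; _,_)
open import Relation.Binary.PropositionalEquality
  using (_≡_; refl; sym; cong; cong₂; module ≡-Reasoning)

module KernelProperties {c : Level} (A : SemiDeMorganAlgebra c) where
  open SemiDeMorganAlgebra A
  open Kernel A
  open ≡-Reasoning

  prime-absorbs-′′ : ∀ a → ((a ′) ′) ′ ≡ a ′
  prime-absorbs-′′ a = sym (′′′ a)

  ′′-idempotent : ∀ a → (((a ′) ′) ′) ′ ≡ (a ′) ′
  ′′-idempotent a = cong _′ (prime-absorbs-′′ a)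

  e-fixed : ∀ (α : K) → (e α ′) ′ ≡ e α
  e-fixed (_ , a , refl) = ′′-idempotent a

  ∧-of-fixed : ∀ x y → (x ′) ′ ≡ x → (y ′) ′ ≡ y → ((x ∧ y) ′) ′ ≡ x ∧ y
  ∧-of-fixed x y x-fixed y-fixed = begin
    ((x ∧ y) ′) ′      ≡⟨ ∧-′′ x y ⟩
    (x ′) ′ ∧ (y ′) ′  ≡⟨ cong₂ _∧_ x-fixed y-fixed ⟩
    x ∧ y              ∎

  ′-of-∨-′′ : ∀ a b → ((a ′) ′ ∨ (b ′) ′) ′ ≡ (a ∨ b) ′
  ′-of-∨-′′ a b = begin
    ((a ′) ′ ∨ (b ′) ′) ′          ≡⟨ ∨-′ _ _ ⟩
    ((a ′) ′) ′ ∧ ((b ′) ′) ′      ≡⟨ cong₂ _∧_ (prime-absorbs-′′ a) (prime-absorbs-′′ b) ⟩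
    a ′ ∧ b ′                      ≡⟨ sym (∨-′ a b) ⟩
    (a ∨ b) ′                      ∎

  h-∧ : ∀ a b → h (a ∧ b) ≈K h a ∩ h b
  h-∧ a b = begin
    ((a ∧ b) ′) ′                  ≡⟨ ∧-′′ a b ⟩
    (a ′) ′ ∧ (b ′) ′              ≡⟨ sym (∧-of-fixed _ _ (′′-idempotent a) (′′-idempotent b)) ⟩
    (((a ′) ′ ∧ (b ′) ′) ′) ′      ∎

  h-∨ : ∀ a b → h (a ∨ b) ≈K h a ∪ h b
  h-∨ a b = begin
    ((a ∨ b) ′) ′                          ≡⟨ cong _′ (sym (′-of-∨-′′ a b)) ⟩
    (((a ′) ′ ∨ (b ′) ′) ′) ′              ≡⟨ sym (′′-idempotent ((a ′) ′ ∨ (b ′) ′)) ⟩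
    (((((a ′) ′ ∨ (b ′) ′) ′) ′) ′) ′      ∎

  h-onto : ∀ (α : K) → ∃ (λ a → h a ≈K α)
  h-onto (_ , a , x≡a′′) = a , sym x≡a′′

  e-∩ : ∀ (α β : K) → e α ∧ e β ≡ e (α ∩ β)
  e-∩ α β = sym (∧-of-fixed (e α) (e β) (e-fixed α) (e-fixed β))

  e-𝟙 : e 𝟙 ≡ ⊤
  e-𝟙 = begin
    (⊤ ′) ′  ≡⟨ cong _′ ⊤′≡⊥ ⟩
    ⊥ ′      ≡⟨ ⊥′≡⊤ ⟩
    ⊤        ∎

  e-𝟘 : e 𝟘 ≡ ⊥
  e-𝟘 = begin
    (⊥ ′) ′  ≡⟨ cong _′ ⊥′≡⊤ ⟩
    ⊤ ′      ≡⟨ ⊤′≡⊥ ⟩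
    ⊥        ∎

proposition3p5 : ∀ {c : Level} (A : SemiDeMorganAlgebra c) →
    let open SemiDeMorganAlgebra A
        open Kernel A
    in ((∀ a b → h (a ∧ b) ≈K h a ∩ h b)
         × (∀ a b → h (a ∨ b) ≈K h a ∪ h b)
         × (∀ (α : K) → ∃ (λ a → h a ≈K α)))
       × (∀ (α β : K) → e α ∧ e β ≡ e (α ∩ β))
       × e 𝟙 ≡ ⊤
       × e 𝟘 ≡ ⊥
proposition3p5 A = (h-∧ , h-∨ , h-onto) , e-∩ , e-𝟙 , e-𝟘
  where open KernelProperties A
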